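{- The class $\mathcal{C}$ of all finite digraphs that have an oriented cycle with non-zero net length can be decided by an adaptive right unbounded query algorithm over $\mathbb{B}$, and not by an adaptive right $k$-query algorithm over $\mathbb{B}$, for any $k$.
   Context: Digraphs are finite structures $(V,R)$, $V\neq\varnothing$, $R\subseteq V\times V$; $\mathsf{FIN}$ is the class of all digraphs. An oriented walk is $(a_0,r_0,a_1,\dots,a_n,r_n,a_{n+1})$ with $r_i\in\{+,-\}$, where $r_i=+$ requires $(a_i,a_{i+1})\in R$ and $r_i=-$ requires $(a_{i+1},a_i)\in R$; its net length is $\#\{i:r_i=+\}-\#\{i:r_i=-\}$; an oriented cycle is such a walk with $a_{n+1}=a_0$, $n\ge0$, and $a_0,\dots,a_n$ pairwise distinct. $\hom_{\mathbb{B}}(A,F)$ is $1$ if there is a homomorphism $A\to F$ and $0$ otherwise. For a set $\Sigma$, $\Sigma^{<\omega}$ is the set of finite strings over $\Sigma$; a subtree is a prefix-closed subset, a leaf an element with no proper extension. An adaptive right query algorithm over $\mathbb{B}$ is a function $G:\mathcal{T}\to\mathsf{FIN}\cup\{\mathsf{YES},\mathsf{NO}\}$ with $\mathcal{T}\subseteq\{0,1\}^{<\omega}$ a subtree and $G(\sigma)\in\{\mathsf{YES},\mathsf{NO}\}$ iff $\sigma$ is a leaf; its computation path on $A$ is the limit of $\sigma_0=\varepsilon$, $\sigma_{i+1}=\sigma_i$ if $G(\sigma_i)\in\{\mathsf{YES},\mathsf{NO}\}$, else $\sigma_{i+1}=\sigma_i\bullet\hom_{\mathbb{B}}(A,G(\sigma_i))$;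 it must be total (finite path for every input), is called unbounded in general, and decides $\{A:G(\text{path of }A)=\mathsf{YES}\}$. It is an adaptive right $k$-query algorithm if all computation paths have length at most $k$. -}

module Defs where

open import Data.Nat using (ℕ; zero; suc; _≤_)
open import Data.Integer using (ℤ; 0ℤ; 1ℤ; -1ℤ; _+_)
open import Data.Fin using (Fin; zero; suc; inject₁; fromℕ)
open import Data.Bool using (Bool; true; false; if_then_else_)
open import Data.List using (List; []; _∷ʳ_; _++_; length)
open import Data.Product using (Σ; _×_; _,_)
open import Data.Sum using (_⊎_)
open import Relation.Binary.PropositionalEquality using (_≡_)
open import Relation.Nullary using (¬_)
open import Function.Bundles using (_⇔_)

record Digraph : Set where
  field
    size : ℕ
    E    : Fin (suc size) → Fin (suc size) → Bool

open Digraph public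

V : Digraph → Set
V A = Fin (suc (size A))

Edge : (A : Digraph) → V A → V A → Set
Edge A x y = E A x y ≡ true

Hom : Digraph → Digraph → Set
Hom A F = Σ (V A → V F) λ f → ∀ x y → Edge A x y → Edge F (f x) (f y)

-- Oriented cycles (a₀, r₀, a₁, …, aₙ, rₙ, aₙ₊₁ = a₀), aᵢ (i ≤ n) distinct.
-- Direction r i = true means '+', false means '-'.

sumℤ : ∀ {m} → (Fin m → ℤ) → ℤ
sumℤ {zero}  f = 0ℤ
sumℤ {suc m} f = f zero + sumℤ (λ i → f (suc i))

record OrientedCycle (A : Digraph) : Set where
  field
    len      : ℕ                          -- this is n (n ≥ 0)
    vert     : Fin (suc (suc len)) → V A
    dir      : Fin (suc len) → Bool
    closed   : vert (fromℕ (suc len)) ≡ vert zero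
    distinct : ∀ i j → vert (inject₁ i) ≡ vert (inject₁ j) → i ≡ j
    steps    : ∀ i → if dir i
                     then Edge A (vert (inject₁ i)) (vert (suc i))
                     else Edge A (vert (suc i)) (vert (inject₁ i))

netLength : ∀ {A} → OrientedCycle A → ℤ
netLength c = sumℤ (λ i → if OrientedCycle.dir c i then 1ℤ else -1ℤ)

HasNonzeroCycle : Digraph → Set
HasNonzeroCycle A = Σ (OrientedCycle A) λ c → ¬ (netLength c ≡ 0ℤ)

data Node : Set where
  query : Digraph → Node
  YES   : Node
  NO    : Node

IsAnswer : Node → Set
IsAnswer n = (n ≡ YES) ⊎ (n ≡ NO)

-- bit b (true = 1) equals hom_𝔹(A, F)
HomBit : Digraph → Digraph → Bool → Set
HomBit A F b = (b ≡ true) ⇔ Hom A F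

record Algorithm : Set₁ where
  field
    T        : List Bool → Set
    G        : List Bool → Node                        -- only meaningful on 𝒯
    prefix   : ∀ σ τ → T (σ ++ τ) → T σ
    leafIff  : ∀ σ → T σ →
               IsAnswer (G σ) ⇔ (∀ τ → T (σ ++ τ) → τ ≡ [])

open Algorithm public

-- σ is one of the σᵢ of the computation sequence of G on A
-- (each σᵢ₊₁ = σᵢ • hom_𝔹(A, G(σᵢ)) when G(σᵢ) is a query).
data Reaches (G' : Algorithm) (A : Digraph) : List Bool → Set where
  start : Reaches G' A []
  step  : ∀ {σ F b} → Reaches G' A σ → T G' σ → G G' σ ≡ query F →
          HomBit A F b → Reaches G' A (σ ∷ʳ b)

Path : Algorithm → Digraph → List Bool → Set
Path G' A σ = Reaches G' A σ × T G' σ × IsAnswer (G G' σ)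

Total : Algorithm → Set
Total G' = ∀ A → Σ (List Bool) (Path G' A)

Decides : Algorithm → (Digraph → Set) → Set
Decides G' C = Total G' × (∀ A σ → Path G' A σ → ((G G' σ ≡ YES) ⇔ C A))

IsKQuery : ℕ → Algorithm → Set
IsKQuery k G' = ∀ A σ → Path G' A σ → length σ ≤ k

module Submission where

-- Homomorphisms preserve net lengths of closed walks, and in the directed cycle C m every
-- closed walk has net length divisible by m + 1.  Hence A → C m excludes nonzero cycles
-- of net length at most m, and A → P n (which implies A → C m for every m) excludes all
-- of them.  Conversely, if A has no nonzero cycle then any walk can be shortened to a
-- simple one of the same net length, so a Bellman–Ford iteration maximising - net over
-- walks from each vertex stabilises after size A rounds and yields a height function
-- A → P (size A).  Asking "A → P i?" and "A → C i?" for i = 0, 1, … therefore decides 𝒞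
-- and always stops.  A k-query algorithm only asks about digraphs F with at most M + 1
-- vertices; for K + 1 = (M + 2)!, a homomorphism P K → F wraps around a closed directed
-- walk whose length divides K + 1, so P K → F iff C K → F, and the algorithm cannot
-- separate P K ∉ 𝒞 from C K ∈ 𝒞.

open import Defs
open import Data.Nat as ℕ using (ℕ; zero; suc; _≤_; _<_; z≤n; s≤s; _%_; _⊓_; _⊔_; _!; pred)
import Data.Nat.Properties as ℕ
open import Data.Nat.DivMod
  using ( _mod_; _/_; m%n<n; %-distribˡ-+; m%n%n≡m%n; m∣n⇒o%n%m≡o%m
        ; m<n⇒m%n≡m; n%n≡0; m≡m%n+[m/n]*n)
open import Data.Nat.Divisibility using (_∣_; ∣-trans; m∣m*n; ∣⇒≤; m≤n⇒m!∣n!)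
open import Data.Integer as ℤ using (ℤ; 0ℤ; 1ℤ; -1ℤ; _+_; _-_; -_; +_; ∣_∣; +≤+)
import Data.Integer.Properties as ℤ
open import Data.Integer.Divisibility.Signed
  using (divides; ∣m⇒∣-m; ∣m∣n⇒∣m+n; ∣⇒∣ᵤ) renaming (_∣_ to _∣ℤ_)
open import Data.Integer.Tactic.RingSolver using (solve-∀)
open import Algebra.Properties.AbelianGroup ℤ.+-0-abelianGroup using (xyx⁻¹≈y)
open import Data.Fin as Fin
  using (Fin; zero; suc; toℕ; inject₁; inject≤; fromℕ; fromℕ<; finToFun; funToFin)
import Data.Fin.Properties as Fin
open import Data.Bool using (Bool; true; false; if_then_else_)
import Data.Bool.Properties as Bool
open import Data.List as List using (List; []; _∷_; _++_; _∷ʳ_; map; allFin; cartesianProduct)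
import Data.List.Properties as List
open import Data.List.Relation.Unary.All as All using ()
import Data.List.Relation.Unary.All.Properties as All
open import Data.List.Relation.Unary.Any using (here; there)
open import Data.List.Membership.Propositional using (_∈_; _∉_)
open import Data.List.Membership.Propositional.Properties
  using (∈-map⁺; ∈-cartesianProduct⁺; ∈-allFin)
import Data.List.Membership.DecPropositional as DecMembership
open import Data.List.Extrema ℤ.≤-totalOrder
  using (argmax; f[⊥]≤f[argmax]; f[xs]≤f[argmax]; argmax-all)
open import Data.Product using (Σ; ∃₂; _×_; _,_; proj₁; proj₂; -,_)
open import Data.Sum as Sum using (_⊎_; inj₁; inj₂)
open import Data.Unit using (⊤; tt)
open import Data.Empty using (⊥-elim)
open import Function using (_∘_; id; const; flip; _$_)
open import Function.Definitions using (Injective)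
open import Function.Bundles using (_⇔_; mk⇔; Equivalence)
import Function.Properties.Equivalence as ⇔
open import Level using (0ℓ)
open import Relation.Binary using (Rel; Decidable)
open import Relation.Binary.PropositionalEquality
open import Relation.Binary.Construct.Closure.ReflexiveTransitive using (Star; ε; _◅_; _◅◅_; gmap)
open import Relation.Nullary using (¬_; Dec; yes; no; contradiction)
open import Relation.Nullary.Decidable using (⌊_⌋; toWitness; fromWitness; map′; _→-dec_)

-- Walks and oriented cycles

record Step (A : Digraph) (x y : V A) : Set where
  constructor mkStep
  field
    dir : Bool
    arc : if dir then Edge A x y else Edge A y x

Walk : (A : Digraph) → Rel (V A) 0ℓ
Walk A = Star (Step A)

sign : Bool → ℤ
sign d = if d then 1ℤ else -1ℤ

module _ {A : Digraph} where

  open DecMembership (Fin._≟_ {suc (size A)}) using (_∈?_)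

  net : ∀ {x y} → Walk A x y → ℤ
  net ε                = 0ℤ
  net (mkStep d _ ◅ w) = sign d + net w

  length : ∀ {x y} → Walk A x y → ℕ
  length ε       = 0
  length (_ ◅ w) = suc (length w)

  net-◅◅ : ∀ {x y z} (w : Walk A x y) (w′ : Walk A y z) → net (w ◅◅ w′) ≡ net w + net w′
  net-◅◅ ε                w′ = sym (ℤ.+-identityˡ (net w′))
  net-◅◅ (mkStep d _ ◅ w) w′ = begin
    sign d + net (w ◅◅ w′)     ≡⟨ cong (_+_ (sign d)) (net-◅◅ w w′) ⟩
    sign d + (net w + net w′)  ≡⟨ ℤ.+-assoc (sign d) (net w) (net w′) ⟨
    sign d + net w + net w′    ∎
    where open ≡-Reasoning

  vertices : ∀ {x y} → Walk A x y → List (V A)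
  vertices {x} ε       = x ∷ []
  vertices {x} (_ ◅ w) = x ∷ vertices w

  Simple : ∀ {x y} → Walk A x y → Set
  Simple     ε       = ⊤
  Simple {x} (_ ◅ w) = x ∉ vertices w × Simple w

  ∈-vertices-◅◅ˡ : ∀ {v x y z} (w : Walk A x y) (w′ : Walk A y z) →
                   v ∈ vertices w → v ∈ vertices (w ◅◅ w′)
  ∈-vertices-◅◅ˡ ε       ε       v∈          = v∈
  ∈-vertices-◅◅ˡ ε       (_ ◅ _) (here refl) = here refl
  ∈-vertices-◅◅ˡ (_ ◅ w) w′      (here refl) = here refl
  ∈-vertices-◅◅ˡ (_ ◅ w) w′      (there v∈)  = there (∈-vertices-◅◅ˡ w w′ v∈)

  Simple-◅◅⁻ : ∀ {x y z} (w : Walk A x y) (w′ : Walk A y z) →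
               Simple (w ◅◅ w′) → Simple w × Simple w′
  Simple-◅◅⁻ ε       w′ simple        = tt , simple
  Simple-◅◅⁻ (_ ◅ w) w′ (x∉ , simple) =
    let simple-w , simple-w′ = Simple-◅◅⁻ w w′ simple
    in (x∉ ∘ ∈-vertices-◅◅ˡ w w′ , simple-w) , simple-w′

  split-at : ∀ {v y z} (w : Walk A y z) → v ∈ vertices w →
             Σ (Walk A y v) λ p → Σ (Walk A v z) λ q → w ≡ p ◅◅ q
  split-at ε       (here refl) = ε , ε , refl
  split-at (s ◅ w) (here refl) = ε , s ◅ w , refl
  split-at (s ◅ w) (there v∈) with split-at w v∈
  ... | p , q , refl = s ◅ p , q , refl

  vertexAt : ∀ {x y} (w : Walk A x y) → Fin (suc (length w)) → V A
  vertexAt {x} w       zero    = x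
  vertexAt     (_ ◅ w) (suc i) = vertexAt w i

  stepAt : ∀ {x y} (w : Walk A x y) (i : Fin (length w)) →
           Step A (vertexAt w (inject₁ i)) (vertexAt w (suc i))
  stepAt (s ◅ w) zero    = s
  stepAt (_ ◅ w) (suc i) = stepAt w i

  vertexAt-last : ∀ {x y} (w : Walk A x y) → vertexAt w (fromℕ (length w)) ≡ y
  vertexAt-last ε       = refl
  vertexAt-last (_ ◅ w) = vertexAt-last w

  vertexAt-∈ : ∀ {x y} (w : Walk A x y) i → vertexAt w i ∈ vertices w
  vertexAt-∈ ε       zero    = here refl
  vertexAt-∈ (_ ◅ w) zero    = here refl
  vertexAt-∈ (_ ◅ w) (suc i) = there (vertexAt-∈ w i)

  sumℤ-stepAt : ∀ {x y} (w : Walk A x y) → sumℤ (λ i → sign (Step.dir (stepAt w i))) ≡ net w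
  sumℤ-stepAt ε                = refl
  sumℤ-stepAt (mkStep d _ ◅ w) = cong (_+_ (sign d)) (sumℤ-stepAt w)

  Simple⇒vertexAt-injective : ∀ {x y} (w : Walk A x y) → Simple w → Injective _≡_ _≡_ (vertexAt w)
  Simple⇒vertexAt-injective w       _            {zero}  {zero}  _ = refl
  Simple⇒vertexAt-injective (_ ◅ w) (x∉ , _)     {zero}  {suc j} e =
    ⊥-elim (x∉ (subst (_∈ vertices w) (sym e) (vertexAt-∈ w j)))
  Simple⇒vertexAt-injective (_ ◅ w) (x∉ , _)     {suc i} {zero}  e =
    ⊥-elim (x∉ (subst (_∈ vertices w) e (vertexAt-∈ w i)))
  Simple⇒vertexAt-injective (_ ◅ w) (_ , simple) {suc i} {suc j} e =
    cong suc (Simple⇒vertexAt-injective w simple e)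

  Simple⇒length≤size : ∀ {x y} (w : Walk A x y) → Simple w → length w ≤ size A
  Simple⇒length≤size w simple = ℕ.s≤s⁻¹ (Fin.injective⇒≤ (Simple⇒vertexAt-injective w simple))

  -- The first vertices of the steps of t ◅ w are x and all vertices of w but the last,
  -- which is x again.
  sources-injective : ∀ {x y} (t : Step A x y) (w : Walk A y x) → Simple w →
                      Injective _≡_ _≡_ (vertexAt (t ◅ w) ∘ inject₁)
  sources-injective t w simple {zero}  {zero}  _ = refl
  sources-injective t w simple {zero}  {suc j} e = ⊥-elim (Fin.fromℕ≢inject₁ {i = j}
    (Simple⇒vertexAt-injective w simple (trans (vertexAt-last w) e)))
  sources-injective t w simple {suc i} {zero}  e = ⊥-elim (Fin.fromℕ≢inject₁ {i = i}
    (Simple⇒vertexAt-injective w simple (trans (vertexAt-last w) (sym e))))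
  sources-injective t w simple {suc i} {suc j} e =
    cong suc (Fin.inject₁-injective (Simple⇒vertexAt-injective w simple e))

  loopCycle : ∀ {x y} (t : Step A x y) (w : Walk A y x) → Simple w → OrientedCycle A
  loopCycle t w simple = record
    { len      = length w
    ; vert     = vertexAt (t ◅ w)
    ; dir      = λ i → Step.dir (stepAt (t ◅ w) i)
    ; closed   = vertexAt-last w
    ; distinct = λ i j → sources-injective t w simple
    ; steps    = λ i → Step.arc (stepAt (t ◅ w) i)
    }

  nonzeroLoop⇒nonzeroCycle : ∀ {x y} (t : Step A x y) (w : Walk A y x) → Simple w →
                             net (t ◅ w) ≢ 0ℤ → HasNonzeroCycle A
  nonzeroLoop⇒nonzeroCycle t w simple nonzero =
    loopCycle t w simple , nonzero ∘ trans (sym (sumℤ-stepAt (t ◅ w)))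

  -- Once the tail is simplified, a repetition of the first vertex closes a simple loop:
  -- it is cut out if its net length is zero and is a nonzero cycle otherwise.
  simplify : ∀ {x y} (w : Walk A x y) →
             (Σ (Walk A x y) λ w′ → Simple w′ × net w′ ≡ net w) ⊎ HasNonzeroCycle A
  simplify ε = inj₁ (ε , tt , refl)
  simplify {x} (s@(mkStep d _) ◅ w) with simplify w
  ... | inj₂ cycle = inj₂ cycle
  ... | inj₁ (w′ , simple , net-w′) with x ∈? vertices w′
  ...   | no x∉ = inj₁ (s ◅ w′ , (x∉ , simple) , cong (_+_ (sign d)) net-w′)
  ...   | yes x∈ with split-at w′ x∈
  ...     | p , q , refl with net (s ◅ p) ℤ.≟ 0ℤ
  ...       | no  loop≢0 =
    inj₂ (nonzeroLoop⇒nonzeroCycle s p (proj₁ (Simple-◅◅⁻ p q simple)) loop≢0)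
  ...       | yes loop≡0 = inj₁ (q , proj₂ (Simple-◅◅⁻ p q simple) , net-q)
    where
    net-q : net q ≡ sign d + net w
    net-q = begin
      net q                     ≡⟨ ℤ.+-identityˡ (net q) ⟨
      0ℤ + net q                ≡⟨ cong (_+ net q) loop≡0 ⟨
      sign d + net p + net q    ≡⟨ ℤ.+-assoc (sign d) (net p) (net q) ⟩
      sign d + (net p + net q)  ≡⟨ cong (_+_ (sign d)) (trans (sym (net-◅◅ p q)) net-w′) ⟩
      sign d + net w            ∎
      where open ≡-Reasoning

  walkAlong : ∀ n (a : Fin (suc n) → V A) → (∀ i → Step A (a (inject₁ i)) (a (suc i))) →
              Walk A (a zero) (a (fromℕ n))
  walkAlong zero    a s = ε
  walkAlong (suc n) a s = s zero ◅ walkAlong n (a ∘ suc) (s ∘ suc)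

  net-walkAlong : ∀ n (a : Fin (suc n) → V A) (s : ∀ i → Step A (a (inject₁ i)) (a (suc i))) →
                  net (walkAlong n a s) ≡ sumℤ (λ i → sign (Step.dir (s i)))
  net-walkAlong zero    a s = refl
  net-walkAlong (suc n) a s =
    cong (_+_ (sign (Step.dir (s zero)))) (net-walkAlong n (a ∘ suc) (s ∘ suc))

  cycleWalk : (c : OrientedCycle A) → let open OrientedCycle c in
              Walk A (vert zero) (vert (fromℕ (suc len)))
  cycleWalk c = walkAlong (suc len) vert (λ i → mkStep (dir i) (steps i))
    where open OrientedCycle c

  net-cycleWalk : (c : OrientedCycle A) → net (cycleWalk c) ≡ netLength c
  net-cycleWalk c = net-walkAlong (suc len) vert (λ i → mkStep (dir i) (steps i))
    where open OrientedCycle c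

_∘ᴴ_ : ∀ {A B F} → Hom B F → Hom A B → Hom A F
(g , g-hom) ∘ᴴ (f , f-hom) = g ∘ f , λ x y e → g-hom (f x) (f y) (f-hom x y e)

mapStep : ∀ {A B} (h : Hom A B) {x y} → Step A x y → Step B (proj₁ h x) (proj₁ h y)
mapStep h (mkStep true  e) = mkStep true  (proj₂ h _ _ e)
mapStep h (mkStep false e) = mkStep false (proj₂ h _ _ e)

mapWalk : ∀ {A B} (h : Hom A B) {x y} → Walk A x y → Walk B (proj₁ h x) (proj₁ h y)
mapWalk h = gmap (proj₁ h) (mapStep h)

net-mapWalk : ∀ {A B} (h : Hom A B) {x y} (w : Walk A x y) → net (mapWalk {A} {B} h w) ≡ net w
net-mapWalk h ε                    = refl
net-mapWalk h (mkStep true  _ ◅ w) = cong (_+_ 1ℤ) (net-mapWalk h w)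
net-mapWalk h (mkStep false _ ◅ w) = cong (_+_ -1ℤ) (net-mapWalk h w)

-- The digraphs P n and C m

fromDec : (n : ℕ) {R : Rel (Fin (suc n)) 0ℓ} → Decidable R → Digraph
fromDec n R? = record { size = n ; E = λ i j → ⌊ R? i j ⌋ }

fromDec-edge : ∀ n {R : Rel (Fin (suc n)) 0ℓ} (R? : Decidable R) {i j} →
               Edge (fromDec n R?) i j ⇔ R i j
fromDec-edge n R? = ⇔.trans (⇔.sym Bool.T-≡) (mk⇔ toWitness fromWitness)

P : ℕ → Digraph
P n = fromDec n λ i j → toℕ j ℕ.≟ suc (toℕ i)

C : ℕ → Digraph
C m = fromDec m λ i j → toℕ j ℕ.≟ suc (toℕ i) % suc m

P-edge : ∀ {n} {i j : V (P n)} → Edge (P n) i j ⇔ toℕ j ≡ suc (toℕ i)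
P-edge {n} = fromDec-edge n λ i j → toℕ j ℕ.≟ suc (toℕ i)

C-edge : ∀ {m} {i j : V (C m)} → Edge (C m) i j ⇔ toℕ j ≡ suc (toℕ i) % suc m
C-edge {m} = fromDec-edge m λ i j → toℕ j ℕ.≟ suc (toℕ i) % suc m

suc-% : ∀ n d .{{_ : ℕ.NonZero d}} → suc n % d ≡ suc (n % d) % d
suc-% n d = begin
  (1 ℕ.+ n) % d              ≡⟨ %-distribˡ-+ 1 n d ⟩
  (1 % d ℕ.+ n % d) % d      ≡⟨ cong (λ r → (1 % d ℕ.+ r) % d) (m%n%n≡m%n n d) ⟨
  (1 % d ℕ.+ n % d % d) % d  ≡⟨ %-distribˡ-+ 1 (n % d) d ⟨
  (1 ℕ.+ n % d) % d          ∎
  where open ≡-Reasoning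

toℕ-mod : ∀ n d .{{_ : ℕ.NonZero d}} → toℕ (n mod d) ≡ n % d
toℕ-mod n d = Fin.toℕ-fromℕ< (m%n<n n d)

mod-edge : ∀ {n m} {i j : Fin n} → suc (toℕ i) % suc m ≡ toℕ j % suc m →
           Edge (C m) (toℕ i mod suc m) (toℕ j mod suc m)
mod-edge {m = m} {i} {j} i+1≡j = Equivalence.from C-edge $ begin
  toℕ (toℕ j mod suc m)                ≡⟨ toℕ-mod (toℕ j) (suc m) ⟩
  toℕ j % suc m                        ≡⟨ i+1≡j ⟨
  suc (toℕ i) % suc m                  ≡⟨ suc-% (toℕ i) (suc m) ⟩
  suc (toℕ i % suc m) % suc m          ≡⟨ cong (λ r → suc r % suc m) (toℕ-mod (toℕ i) (suc m)) ⟨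
  suc (toℕ (toℕ i mod suc m)) % suc m  ∎
  where open ≡-Reasoning

P⇒C : ∀ {n m} → Hom (P n) (C m)
P⇒C {m = m} = (λ i → toℕ i mod suc m) ,
  λ i j e → mod-edge {i = i} {j} (cong (_% suc m) (sym (Equivalence.to P-edge e)))

C⇒C : ∀ {K ℓ} → suc ℓ ∣ suc K → Hom (C K) (C ℓ)
C⇒C {K} {ℓ} ℓ+1∣K+1 = (λ i → toℕ i mod suc ℓ) , λ i j e → mod-edge {i = i} {j} $ begin
  suc (toℕ i) % suc ℓ          ≡⟨ m∣n⇒o%n%m≡o%m (suc ℓ) (suc K) (suc (toℕ i)) ℓ+1∣K+1 ⟨
  suc (toℕ i) % suc K % suc ℓ  ≡⟨ cong (_% suc ℓ) (Equivalence.to C-edge e) ⟨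
  toℕ j % suc ℓ                ∎
  where open ≡-Reasoning

P-mono : ∀ {n m} → n ≤ m → Hom (P n) (P m)
P-mono n≤m = (λ i → inject≤ i (s≤s n≤m)) , λ i j e → Equivalence.from P-edge $ begin
  toℕ (inject≤ j _)        ≡⟨ Fin.toℕ-inject≤ j _ ⟩
  toℕ j                    ≡⟨ Equivalence.to P-edge e ⟩
  suc (toℕ i)              ≡⟨ cong suc (Fin.toℕ-inject≤ i _) ⟨
  suc (toℕ (inject≤ i _))  ∎
  where open ≡-Reasoning

potential⇒Hom-P : ∀ {A n} (h : V A → ℕ) → (∀ v → h v ≤ n) →
                  (∀ x y → Edge A x y → h y ≡ suc (h x)) → Hom A (P n)
potential⇒Hom-P {A} {n} h bound rise = f , λ x y e → Equivalence.from P-edge $ begin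
  toℕ (f y)        ≡⟨ Fin.toℕ-fromℕ< _ ⟩
  h y              ≡⟨ rise x y e ⟩
  suc (h x)        ≡⟨ cong suc (Fin.toℕ-fromℕ< _) ⟨
  suc (toℕ (f x))  ∎
  where
  open ≡-Reasoning
  f : V A → V (P n)
  f v = fromℕ< (s≤s (bound v))

C-arc : ∀ {m} {x y : V (C m)} → Edge (C m) x y → + suc m ∣ℤ + suc (toℕ x) - + toℕ y
C-arc {m} {x} {y} e = divides (+ q) $ begin
  + suc (toℕ x) - + toℕ y                ≡⟨ cong (λ k → + k - + toℕ y) x+1≡y+q[m+1] ⟩
  + (toℕ y ℕ.+ q ℕ.* suc m) - + toℕ y    ≡⟨ cong (_- + toℕ y) (ℤ.pos-+ (toℕ y) (q ℕ.* suc m)) ⟩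
  + toℕ y + + (q ℕ.* suc m) - + toℕ y    ≡⟨ xyx⁻¹≈y (+ toℕ y) (+ (q ℕ.* suc m)) ⟩
  + (q ℕ.* suc m)                        ≡⟨ ℤ.pos-* q (suc m) ⟩
  + q ℤ.* + suc m                        ∎
  where
  open ≡-Reasoning
  q : ℕ
  q = suc (toℕ x) / suc m
  x+1≡y+q[m+1] : suc (toℕ x) ≡ toℕ y ℕ.+ q ℕ.* suc m
  x+1≡y+q[m+1] = trans (m≡m%n+[m/n]*n (suc (toℕ x)) (suc m))
                       (cong (ℕ._+ q ℕ.* suc m) (sym (Equivalence.to C-edge e)))

C-step : ∀ {m} {x y : V (C m)} (s : Step (C m) x y) →
         + suc m ∣ℤ + toℕ x + sign (Step.dir s) - + toℕ y
C-step {m} {x} {y} (mkStep true  e) =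
  subst (λ k → + suc m ∣ℤ k - + toℕ y) (ℤ.+-comm 1ℤ (+ toℕ x)) (C-arc e)
C-step {m} {x} {y} (mkStep false e) =
  subst (+ suc m ∣ℤ_) (backward (+ toℕ x) (+ toℕ y)) (∣m⇒∣-m (C-arc e))
  where
  backward : ∀ a b → - (1ℤ + b - a) ≡ a + -1ℤ - b
  backward = solve-∀

C-walk : ∀ {m} {x y : V (C m)} (w : Walk (C m) x y) → + suc m ∣ℤ + toℕ x + net w - + toℕ y
C-walk {m} {x} ε = subst (+ suc m ∣ℤ_) (sym (xyx⁻¹≈y (+ toℕ x) 0ℤ)) (divides 0ℤ refl)
C-walk {m} {x} {y} (s@(mkStep d _) ◅ w) = subst (+ suc m ∣ℤ_)
  (regroup (+ toℕ x) (sign d) _ (net w) (+ toℕ y)) (∣m∣n⇒∣m+n (C-step s) (C-walk w))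
  where
  regroup : ∀ a d b n c → (a + d - b) + (b + n - c) ≡ a + (d + n) - c
  regroup = solve-∀

Hom-C⇒∣netLength : ∀ {A m} → Hom A (C m) → (c : OrientedCycle A) → + suc m ∣ℤ netLength c
Hom-C⇒∣netLength {A} {m} h c = subst (+ suc m ∣ℤ_) telescope (C-walk (mapWalk h (cycleWalk c)))
  where
  open OrientedCycle c
  a : V A → ℤ
  a v = + toℕ (proj₁ h v)
  telescope : a (vert zero) + net (mapWalk h (cycleWalk c)) - a (vert (fromℕ (suc len)))
              ≡ netLength c
  telescope = begin
    a (vert zero) + net (mapWalk h (cycleWalk c)) - a (vert (fromℕ (suc len)))
      ≡⟨ cong (λ v → a (vert zero) + net (mapWalk h (cycleWalk c)) - a v) closed ⟩
    a (vert zero) + net (mapWalk h (cycleWalk c)) - a (vert zero)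
      ≡⟨ xyx⁻¹≈y (a (vert zero)) _ ⟩
    net (mapWalk h (cycleWalk c))  ≡⟨ net-mapWalk h (cycleWalk c) ⟩
    net (cycleWalk c)              ≡⟨ net-cycleWalk c ⟩
    netLength c                    ∎
    where open ≡-Reasoning

Hom-C⇒m<∣netLength∣ : ∀ {A m} → Hom A (C m) → (c : OrientedCycle A) → netLength c ≢ 0ℤ →
                      m < ∣ netLength c ∣
Hom-C⇒m<∣netLength∣ h c nonzero =
  ∣⇒≤ {{ℕ.≢-nonZero (nonzero ∘ ℤ.∣i∣≡0⇒i≡0)}} (∣⇒∣ᵤ (Hom-C⇒∣netLength h c))

Hom-P⇒¬nonzeroCycle : ∀ {A n} → Hom A (P n) → ¬ HasNonzeroCycle A
Hom-P⇒¬nonzeroCycle {A} {n} h (c , nonzero) =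
  ℕ.<-irrefl refl (Hom-C⇒m<∣netLength∣ (_∘ᴴ_ {A} {P n} {C ∣ netLength c ∣} P⇒C h) c nonzero)

sumℤ-1 : ∀ n → sumℤ {n} (λ _ → 1ℤ) ≡ + n
sumℤ-1 zero    = refl
sumℤ-1 (suc n) = cong (_+_ 1ℤ) (sumℤ-1 n)

C-nonzeroCycle : ∀ m → HasNonzeroCycle (C m)
C-nonzeroCycle m = cycle , λ net≡0 → contradiction (trans (sym (sumℤ-1 (suc m))) net≡0) λ ()
  where
  vert : Fin (suc (suc m)) → V (C m)
  vert i = toℕ i mod suc m

  toℕ-vert-inject₁ : ∀ i → toℕ (vert (inject₁ i)) ≡ toℕ i
  toℕ-vert-inject₁ i = begin
    toℕ (vert (inject₁ i))   ≡⟨ toℕ-mod (toℕ (inject₁ i)) (suc m) ⟩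
    toℕ (inject₁ i) % suc m  ≡⟨ cong (_% suc m) (Fin.toℕ-inject₁ i) ⟩
    toℕ i % suc m            ≡⟨ m<n⇒m%n≡m (Fin.toℕ<n i) ⟩
    toℕ i                    ∎
    where open ≡-Reasoning

  cycle : OrientedCycle (C m)
  cycle = record
    { len      = m
    ; vert     = vert
    ; dir      = λ _ → true
    ; closed   = Fin.toℕ-injective $ begin
        toℕ (vert (fromℕ (suc m)))   ≡⟨ toℕ-mod (toℕ (fromℕ (suc m))) (suc m) ⟩
        toℕ (fromℕ (suc m)) % suc m  ≡⟨ cong (_% suc m) (Fin.toℕ-fromℕ (suc m)) ⟩
        suc m % suc m                ≡⟨ n%n≡0 (suc m) ⟩
        0                            ∎
    ; distinct = λ i j e → Fin.toℕ-injective
        (trans (sym (toℕ-vert-inject₁ i)) (trans (cong toℕ e) (toℕ-vert-inject₁ j)))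
    ; steps    = λ i → mod-edge {i = inject₁ i} {suc i}
        (cong (λ k → suc k % suc m) (Fin.toℕ-inject₁ i))
    }
    where open ≡-Reasoning

closedWalk⇒Hom-C : ∀ {F} ℓ (ρ : ℕ → V F) → (∀ r → r ≤ ℓ → Edge F (ρ r) (ρ (suc r))) →
                   ρ (suc ℓ) ≡ ρ 0 → Hom (C ℓ) F
closedWalk⇒Hom-C {F} ℓ ρ edge closed = ρ ∘ toℕ , hom
  where
  hom : ∀ x y → Edge (C ℓ) x y → Edge F (ρ (toℕ x)) (ρ (toℕ y))
  hom x y e = subst (Edge F (ρ (toℕ x))) (sym (next (ℕ.m≤n⇒m<n∨m≡n x≤ℓ))) (edge (toℕ x) x≤ℓ)
    where
    x≤ℓ : toℕ x ≤ ℓ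
    x≤ℓ = ℕ.s≤s⁻¹ (Fin.toℕ<n x)
    y≡x+1 : toℕ y ≡ suc (toℕ x) % suc ℓ
    y≡x+1 = Equivalence.to C-edge e
    next : toℕ x < ℓ ⊎ toℕ x ≡ ℓ → ρ (toℕ y) ≡ ρ (suc (toℕ x))
    next (inj₁ x<ℓ) = cong ρ (trans y≡x+1 (m<n⇒m%n≡m (s≤s x<ℓ)))
    next (inj₂ x≡ℓ) = begin
      ρ (toℕ y)                ≡⟨ cong ρ y≡x+1 ⟩
      ρ (suc (toℕ x) % suc ℓ)  ≡⟨ cong (λ k → ρ (suc k % suc ℓ)) x≡ℓ ⟩
      ρ (suc ℓ % suc ℓ)        ≡⟨ cong ρ (n%n≡0 (suc ℓ)) ⟩
      ρ 0                      ≡⟨ closed ⟨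
      ρ (suc ℓ)                ≡⟨ cong (ρ ∘ suc) x≡ℓ ⟨
      ρ (suc (toℕ x))          ∎
      where open ≡-Reasoning

-- By pigeonhole the path revisits a vertex within its first size F + 1 steps, and the
-- closed walk in between is the image of a directed cycle.
Hom-P⇒Hom-C : ∀ {K F} → size F < K → Hom (P K) F → Σ ℕ λ ℓ → ℓ ≤ size F × Hom (C ℓ) F
Hom-P⇒Hom-C {K} {F} F<K (h , h-hom) = wrap (Fin.pigeonhole (ℕ.n<1+n (suc (size F))) (ρ ∘ toℕ))
  where
  ρ : ℕ → V F
  ρ n = h (fromℕ< (s≤s (ℕ.m⊓n≤n n K)))

  ρ-edge : ∀ n → n < K → Edge F (ρ n) (ρ (suc n))
  ρ-edge n n<K = h-hom _ _ $ Equivalence.from P-edge $ begin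
    toℕ (fromℕ< _)        ≡⟨ Fin.toℕ-fromℕ< _ ⟩
    suc n ⊓ K             ≡⟨ ℕ.m≤n⇒m⊓n≡m n<K ⟩
    suc n                 ≡⟨ cong suc (ℕ.m≤n⇒m⊓n≡m (ℕ.<⇒≤ n<K)) ⟨
    suc (n ⊓ K)           ≡⟨ cong suc (Fin.toℕ-fromℕ< _) ⟨
    suc (toℕ (fromℕ< _))  ∎
    where open ≡-Reasoning

  wrap : (∃₂ λ i j → i Fin.< j × ρ (toℕ i) ≡ ρ (toℕ j)) → Σ ℕ λ ℓ → ℓ ≤ size F × Hom (C ℓ) F
  wrap (i , j , i<j , ρi≡ρj) =
    ℓ , ℓ≤size , closedWalk⇒Hom-C {F} ℓ (λ r → ρ (a ℕ.+ r)) edge closed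
    where
    a ℓ : ℕ
    a = toℕ i
    ℓ = toℕ j ℕ.∸ suc a

    a+1+ℓ≡j : a ℕ.+ suc ℓ ≡ toℕ j
    a+1+ℓ≡j = trans (ℕ.+-suc a ℓ) (ℕ.m+[n∸m]≡n i<j)

    a+1+ℓ≤size+1 : a ℕ.+ suc ℓ ≤ suc (size F)
    a+1+ℓ≤size+1 = subst (_≤ suc (size F)) (sym a+1+ℓ≡j) (ℕ.s≤s⁻¹ (Fin.toℕ<n j))

    ℓ≤size : ℓ ≤ size F
    ℓ≤size = ℕ.s≤s⁻¹ (ℕ.≤-trans (ℕ.m≤n+m (suc ℓ) a) a+1+ℓ≤size+1)

    edge : ∀ r → r ≤ ℓ → Edge F (ρ (a ℕ.+ r)) (ρ (a ℕ.+ suc r))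
    edge r r≤ℓ = subst (Edge F (ρ (a ℕ.+ r)) ∘ ρ) (sym (ℕ.+-suc a r)) (ρ-edge (a ℕ.+ r) a+r<K)
      where
      a+r<K : a ℕ.+ r < K
      a+r<K = ℕ.<-≤-trans (ℕ.+-monoʳ-< a (s≤s r≤ℓ)) (ℕ.≤-trans a+1+ℓ≤size+1 F<K)

    closed : ρ (a ℕ.+ suc ℓ) ≡ ρ (a ℕ.+ 0)
    closed = begin
      ρ (a ℕ.+ suc ℓ)  ≡⟨ cong ρ a+1+ℓ≡j ⟩
      ρ (toℕ j)        ≡⟨ ρi≡ρj ⟨
      ρ a              ≡⟨ cong ρ (ℕ.+-identityʳ a) ⟨
      ρ (a ℕ.+ 0)      ∎
      where open ≡-Reasoning

P⇔C : ∀ {K F} → size F < K → (∀ ℓ → ℓ ≤ size F → suc ℓ ∣ suc K) → Hom (P K) F ⇔ Hom (C K) F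
P⇔C {K} {F} F<K small∣K+1 =
  mk⇔ (unfold ∘ Hom-P⇒Hom-C {K} {F} F<K) (λ g → _∘ᴴ_ {P K} {C K} {F} g P⇒C)
  where
  unfold : (Σ ℕ λ ℓ → ℓ ≤ size F × Hom (C ℓ) F) → Hom (C K) F
  unfold (ℓ , ℓ≤size , g) = _∘ᴴ_ {C K} {C ℓ} {F} g (C⇒C (small∣K+1 ℓ ℓ≤size))

-- Digraphs without nonzero cycles map to paths

module _ {A : Digraph} where

  Outgoing : V A → Set
  Outgoing v = Σ (V A) (Walk A v)

  gain : ∀ {v} → Outgoing v → ℤ
  gain (_ , w) = - net w

  arc? : ∀ d (x y : V A) → Dec (if d then Edge A x y else Edge A y x)
  arc? true  x y = E A x y Bool.≟ true
  arc? false x y = E A y x Bool.≟ true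

  moves : List (V A × Bool)
  moves = cartesianProduct (allFin (suc (size A))) (true ∷ false ∷ [])

  extend : (∀ u → Outgoing u) → ∀ v → V A × Bool → Outgoing v
  extend b v (u , d) with arc? d v u
  ... | yes a = -, mkStep d a ◅ proj₂ (b u)
  ... | no  _ = b v

  improve : (∀ u → Outgoing u) → ∀ v → Outgoing v
  improve b v = argmax gain (b v) (map (extend b v) moves)

  -- Bellman–Ford on walks: best k v is a walk of length ≤ k from v maximising - net.
  best : ℕ → ∀ v → Outgoing v
  best zero    v = v , ε
  best (suc k)   = improve (best k)

  improve-≥ : ∀ b v → gain (b v) ℤ.≤ gain (improve b v)
  improve-≥ b v = f[⊥]≤f[argmax] {f = gain} (b v) (map (extend b v) moves)

  improve-≥-step : ∀ b {v u} (t : Step A v u) →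
                   - sign (Step.dir t) + gain (b u) ℤ.≤ gain (improve b v)
  improve-≥-step b {v} {u} (mkStep d a) = subst (ℤ._≤ gain (improve b v)) gain-extend
    (All.lookup (f[xs]≤f[argmax] {f = gain} (b v) (map (extend b v) moves))
                (∈-map⁺ (extend b v) (∈-cartesianProduct⁺ (∈-allFin u) (d∈ d))))
    where
    d∈ : ∀ d → d ∈ true ∷ false ∷ []
    d∈ true  = here refl
    d∈ false = there (here refl)
    gain-extend : gain (extend b v (u , d)) ≡ - sign d + gain (b u)
    gain-extend with arc? d v u
    ... | yes _  = ℤ.neg-distrib-+ (sign d) (net (proj₂ (b u)))
    ... | no  ¬a = contradiction a ¬a

  improve-length : ∀ b k → (∀ u → length (proj₂ (b u)) ≤ k) →
                   ∀ v → length (proj₂ (improve b v)) ≤ suc k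
  improve-length b k short v = argmax-all gain {P = λ o → length (proj₂ o) ≤ suc k}
    (ℕ.m≤n⇒m≤1+n (short v)) (All.map⁺ (All.universal extend-length moves))
    where
    extend-length : ∀ m → length (proj₂ (extend b v m)) ≤ suc k
    extend-length (u , d) with arc? d v u
    ... | yes _ = s≤s (short u)
    ... | no  _ = ℕ.m≤n⇒m≤1+n (short v)

  best-length : ∀ k v → length (proj₂ (best k v)) ≤ k
  best-length zero    v = z≤n
  best-length (suc k)   = improve-length (best k) k (best-length k)

  best-nonneg : ∀ k v → 0ℤ ℤ.≤ gain (best k v)
  best-nonneg zero    v = ℤ.≤-refl
  best-nonneg (suc k) v = ℤ.≤-trans (best-nonneg k v) (improve-≥ (best k) v)

  best-optimal : ∀ k {v y} (w : Walk A v y) → length w ≤ k → - net w ℤ.≤ gain (best k v)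
  best-optimal k       ε                      _         = best-nonneg k _
  best-optimal (suc k) (t@(mkStep d _) ◅ w) (s≤s w≤k) = begin
    - (sign d + net w)          ≡⟨ ℤ.neg-distrib-+ (sign d) (net w) ⟩
    - sign d + - net w          ≤⟨ ℤ.+-monoʳ-≤ (- sign d) (best-optimal k w w≤k) ⟩
    - sign d + gain (best k _)  ≤⟨ improve-≥-step (best k) t ⟩
    gain (best (suc k) _)       ∎
    where open ℤ.≤-Reasoning

  -net≤length : ∀ {x y} (w : Walk A x y) → - net w ℤ.≤ + length w
  -net≤length ε                = ℤ.≤-refl
  -net≤length (mkStep d _ ◅ w) = begin
    - (sign d + net w)  ≡⟨ ℤ.neg-distrib-+ (sign d) (net w) ⟩
    - sign d + - net w  ≤⟨ ℤ.+-mono-≤ (-sign≤1 d) (-net≤length w) ⟩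
    1ℤ + + length w     ∎
    where
    open ℤ.≤-Reasoning
    -sign≤1 : ∀ d → - sign d ℤ.≤ 1ℤ
    -sign≤1 true  = ℤ.-≤+
    -sign≤1 false = ℤ.≤-refl

  Stable : V A → Set
  Stable v = gain (best (suc (size A)) v) ℤ.≤ gain (best (size A) v)

  stable⊎nonzeroCycle : ∀ v → Stable v ⊎ HasNonzeroCycle A
  stable⊎nonzeroCycle v = Sum.map₁ simple⇒stable (simplify w)
    where
    w : Walk A v (proj₁ (best (suc (size A)) v))
    w = proj₂ (best (suc (size A)) v)
    simple⇒stable : (Σ (Walk A v (proj₁ (best (suc (size A)) v))) λ w′ →
                      Simple w′ × net w′ ≡ net w) → Stable v
    simple⇒stable (w′ , simple , net-w′) =
      subst (ℤ._≤ gain (best (size A) v)) (cong -_ net-w′)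
            (best-optimal (size A) w′ (Simple⇒length≤size w′ simple))

  stable⇒Hom-P : (∀ v → Stable v) → Hom A (P (size A))
  stable⇒Hom-P stable = potential⇒Hom-P (∣_∣ ∘ height) bound rise
    where
    height : V A → ℤ
    height v = gain (best (size A) v)

    +∣height∣ : ∀ v → + ∣ height v ∣ ≡ height v
    +∣height∣ v = ℤ.0≤i⇒+∣i∣≡i (best-nonneg (size A) v)

    bound : ∀ v → ∣ height v ∣ ≤ size A
    bound v = ℤ.drop‿+≤+ $ begin
      + ∣ height v ∣                      ≡⟨ +∣height∣ v ⟩
      height v                            ≤⟨ -net≤length (proj₂ (best (size A) v)) ⟩
      + length (proj₂ (best (size A) v))  ≤⟨ +≤+ (best-length (size A) v) ⟩
      + size A                            ∎
      where open ℤ.≤-Reasoning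

    descend : ∀ {v u} (t : Step A v u) → - sign (Step.dir t) + height u ℤ.≤ height v
    descend t = ℤ.≤-trans (improve-≥-step (best (size A)) t) (stable _)

    rise : ∀ x y → Edge A x y → ∣ height y ∣ ≡ suc ∣ height x ∣
    rise x y e = cong ∣_∣ $ begin
      height y              ≡⟨ ℤ.≤-antisym y≤1+x (descend (mkStep false e)) ⟩
      1ℤ + height x         ≡⟨ cong (_+_ 1ℤ) (+∣height∣ x) ⟨
      1ℤ + + ∣ height x ∣   ∎
      where
      open ≡-Reasoning
      y≤1+x : height y ℤ.≤ 1ℤ + height x
      y≤1+x = subst (ℤ._≤ 1ℤ + height x)
                    (trans (sym (ℤ.+-assoc 1ℤ -1ℤ (height y))) (ℤ.+-identityˡ (height y)))
                    (ℤ.+-monoʳ-≤ 1ℤ (descend (mkStep true e)))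

  Hom-P⊎nonzeroCycle : Hom A (P (size A)) ⊎ HasNonzeroCycle A
  Hom-P⊎nonzeroCycle = decide (Fin.all? stable?)
    where
    stable? : ∀ v → Dec (Stable v)
    stable? v = gain (best (suc (size A)) v) ℤ.≤? gain (best (size A) v)

    unstable : (Σ (V A) λ v → ¬ Stable v) → HasNonzeroCycle A
    unstable (v , ¬stable) = Sum.[ flip contradiction ¬stable , id ]′ (stable⊎nonzeroCycle v)

    decide : Dec (∀ v → Stable v) → Hom A (P (size A)) ⊎ HasNonzeroCycle A
    decide (yes stable) = inj₁ (stable⇒Hom-P stable)
    decide (no ¬stable) = inj₂ (unstable (Fin.¬∀⟶∃¬ _ Stable stable? ¬stable))

¬Hom-C⇒nonzeroCycle : ∀ {A m} → ¬ Hom A (C m) → HasNonzeroCycle A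
¬Hom-C⇒nonzeroCycle {A} {m} ¬hom = Sum.[ ⊥-elim ∘ ¬Hom-P , id ]′ Hom-P⊎nonzeroCycle
  where
  ¬Hom-P : ¬ Hom A (P (size A))
  ¬Hom-P h = ¬hom (_∘ᴴ_ {A} {P (size A)} {C m} P⇒C h)

DecidedFrom : Digraph → ℕ → Set
DecidedFrom A n₀ = ∀ n → n₀ ≤ n → Hom A (P n) ⊎ ¬ Hom A (C n)

eventually-decided : ∀ A → Σ ℕ (DecidedFrom A)
eventually-decided A = Sum.[ from-Hom-P , from-cycle ]′ Hom-P⊎nonzeroCycle
  where
  from-Hom-P : Hom A (P (size A)) → Σ ℕ (DecidedFrom A)
  from-Hom-P h = size A , λ n size≤n → inj₁ (_∘ᴴ_ {A} {P (size A)} {P n} (P-mono size≤n) h)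

  from-cycle : HasNonzeroCycle A → Σ ℕ (DecidedFrom A)
  from-cycle (c , nonzero) = ∣ netLength c ∣ , λ n net≤n →
    inj₂ λ h → ℕ.<⇒≱ (Hom-C⇒m<∣netLength∣ h c nonzero) net≤n

-- An unbounded query algorithm deciding 𝒞

IsHom : ∀ A F → (V A → V F) → Set
IsHom A F f = ∀ x y → Edge A x y → Edge F (f x) (f y)

IsHom? : ∀ A F f → Dec (IsHom A F f)
IsHom? A F f = Fin.all? λ x → Fin.all? λ y →
  (E A x y Bool.≟ true) →-dec (E F (f x) (f y) Bool.≟ true)

-- Every function Fin n → Fin m agrees pointwise with finToFun k for some k < m ^ n.
Hom? : ∀ A F → Dec (Hom A F)
Hom? A F = map′ (λ (k , hom) → finToFun k , hom) (λ (f , hom) → funToFin f , encode hom)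
                (Fin.any? (IsHom? A F ∘ finToFun))
  where
  encode : ∀ {f} → IsHom A F f → IsHom A F (finToFun (funToFin f))
  encode {f} hom x y e =
    subst₂ (Edge F) (sym (Fin.finToFun-funToFin f x)) (sym (Fin.finToFun-funToFin f y)) (hom x y e)

-- Stage i of the search starts after the answers stage i = (01)ⁱ.  It asks A → P i?
-- (answer 1: NO), then A → C i? (answer 0: YES); otherwise stage i + 1 follows.
stage : ℕ → List Bool
stage zero    = []
stage (suc n) = false ∷ true ∷ stage n

node : ℕ → List Bool → Node
node i []                  = query (P i)
node i (true ∷ _)          = NO
node i (false ∷ [])        = query (C i)
node i (false ∷ false ∷ _) = YES
node i (false ∷ true ∷ σ)  = node (suc i) σ

InTree : List Bool → Set
InTree []                  = ⊤
InTree (true ∷ σ)          = σ ≡ []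
InTree (false ∷ [])        = ⊤
InTree (false ∷ false ∷ σ) = σ ≡ []
InTree (false ∷ true ∷ σ)  = InTree σ

InTree-prefix : ∀ σ τ → InTree (σ ++ τ) → InTree σ
InTree-prefix []                  τ _ = tt
InTree-prefix (true ∷ σ)          τ t = List.++-conicalˡ σ τ t
InTree-prefix (false ∷ [])        τ _ = tt
InTree-prefix (false ∷ false ∷ σ) τ t = List.++-conicalˡ σ τ t
InTree-prefix (false ∷ true ∷ σ)  τ t = InTree-prefix σ τ t

query≢answer : ∀ {F} → ¬ IsAnswer (query F)
query≢answer (inj₁ ())
query≢answer (inj₂ ())

InTree-leaf : ∀ i σ → InTree σ → IsAnswer (node i σ) ⇔ (∀ τ → InTree (σ ++ τ) → τ ≡ [])
InTree-leaf i []                  _    =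
  mk⇔ (⊥-elim ∘ query≢answer) λ leaf → contradiction (leaf (true ∷ []) refl) λ ()
InTree-leaf i (true ∷ σ)          refl = mk⇔ (λ _ τ → id) (λ _ → inj₂ refl)
InTree-leaf i (false ∷ [])        _    =
  mk⇔ (⊥-elim ∘ query≢answer) λ leaf → contradiction (leaf (false ∷ []) refl) λ ()
InTree-leaf i (false ∷ false ∷ σ) refl = mk⇔ (λ _ τ → id) (λ _ → inj₁ refl)
InTree-leaf i (false ∷ true ∷ σ)  t    = InTree-leaf (suc i) σ t

search : Algorithm
search = record { T = InTree ; G = node 0 ; prefix = InTree-prefix ; leafIff = InTree-leaf 0 }

node-stage : ∀ n τ → node 0 (stage n ++ τ) ≡ node n τ
node-stage n τ = trans (shift n 0) (cong (λ i → node i τ) (ℕ.+-identityʳ n))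
  where
  shift : ∀ n i → node i (stage n ++ τ) ≡ node (n ℕ.+ i) τ
  shift zero    i = refl
  shift (suc n) i = trans (shift n (suc i)) (cong (λ j → node j τ) (ℕ.+-suc n i))

InTree-stage : ∀ n τ → InTree τ → InTree (stage n ++ τ)
InTree-stage zero    τ t = t
InTree-stage (suc n) τ t = InTree-stage n τ t

stage-∷ʳ : ∀ n → stage n ∷ʳ false ∷ʳ true ≡ stage (suc n)
stage-∷ʳ zero    = refl
stage-∷ʳ (suc n) = cong (λ σ → false ∷ true ∷ σ) (stage-∷ʳ n)

data Leaf : List Bool → Set where
  rejected : ∀ n → Leaf (stage n ∷ʳ true)
  accepted : ∀ n → Leaf (stage n ∷ʳ false ∷ʳ false)

leaf : ∀ i σ → InTree σ → IsAnswer (node i σ) → Leaf σ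
leaf i []                  _    a = ⊥-elim (query≢answer a)
leaf i (true ∷ σ)          refl _ = rejected 0
leaf i (false ∷ [])        _    a = ⊥-elim (query≢answer a)
leaf i (false ∷ false ∷ σ) refl _ = accepted 0
leaf i (false ∷ true ∷ σ)  t    a with leaf (suc i) σ t a
... | rejected n = rejected (suc n)
... | accepted n = accepted (suc n)

query-injective : ∀ {F F′} → query F ≡ query F′ → F ≡ F′
query-injective refl = refl

reaches-∷ʳ⁻ : ∀ {G A σ b F} → Reaches G A (σ ∷ʳ b) → G .Algorithm.G σ ≡ query F → HomBit A F b
reaches-∷ʳ⁻ {G} {A} {σ} {b} {F} r known = invert r refl
  where
  invert : ∀ {τ} → Reaches G A τ → τ ≡ σ ∷ʳ b → HomBit A F b
  invert start e = contradiction (List.++-conicalʳ σ (b ∷ []) (sym e)) λ ()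
  invert (step {σ′} _ _ asked answered) e with List.∷ʳ-injective σ′ σ e
  ... | refl , refl = subst (λ F → HomBit A F b) (query-injective (trans (sym asked) known)) answered

module _ {A : Digraph} where

  query-P : ∀ n → node 0 (stage n) ≡ query (P n)
  query-P n = trans (cong (node 0) (sym (List.++-identityʳ (stage n)))) (node-stage n [])

  InTree-stage₀ : ∀ n → InTree (stage n)
  InTree-stage₀ n = subst InTree (List.++-identityʳ (stage n)) (InTree-stage n [] tt)

  probe : ∀ {n} → Reaches search A (stage n) → ¬ Hom A (P n) → ∀ b → HomBit A (C n) b →
          Reaches search A (stage n ∷ʳ false ∷ʳ b)
  probe {n} r ¬p b answer = step
    (step r (InTree-stage₀ n) (query-P n) (mk⇔ (λ ()) (⊥-elim ∘ ¬p)))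
    (InTree-stage n (false ∷ []) tt) (node-stage n (false ∷ [])) answer

  reject : ∀ {n} → Reaches search A (stage n) → Hom A (P n) → Path search A (stage n ∷ʳ true)
  reject {n} r p = step r (InTree-stage₀ n) (query-P n) (mk⇔ (const p) (const refl)) ,
                   InTree-stage n (true ∷ []) refl , inj₂ (node-stage n (true ∷ []))

  accept : ∀ {n} → Reaches search A (stage n) → ¬ Hom A (P n) → ¬ Hom A (C n) →
           Path search A (stage n ∷ʳ false ∷ʳ false)
  accept {n} r ¬p ¬c = probe r ¬p false (mk⇔ (λ ()) (⊥-elim ∘ ¬c)) ,
                       subst InTree (sym accepted≡) (InTree-stage n (false ∷ false ∷ []) refl) ,
                       inj₁ (trans (cong (node 0) accepted≡) (node-stage n (false ∷ false ∷ [])))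
    where
    accepted≡ : stage n ∷ʳ false ∷ʳ false ≡ stage n ++ false ∷ false ∷ []
    accepted≡ = List.∷ʳ-++ (stage n) false (false ∷ [])

  continue : ∀ {n} → Reaches search A (stage n) → ¬ Hom A (P n) → Hom A (C n) →
             Reaches search A (stage (suc n))
  continue {n} r ¬p c =
    subst (Reaches search A) (stage-∷ʳ n) (probe r ¬p true (mk⇔ (const c) (const refl)))

  search-sound : ∀ σ → Path search A σ → (node 0 σ ≡ YES ⇔ HasNonzeroCycle A)
  search-sound σ (r , t , a) = at (leaf 0 σ t a) r
    where
    at : ∀ {σ} → Leaf σ → Reaches search A σ → (node 0 σ ≡ YES ⇔ HasNonzeroCycle A)
    at (rejected n) r = mk⇔
      (λ no≡yes → contradiction (trans (sym (node-stage n (true ∷ []))) no≡yes) λ ())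
      (⊥-elim ∘ Hom-P⇒¬nonzeroCycle (Equivalence.to (reaches-∷ʳ⁻ r (query-P n)) refl))
    at (accepted n) r = mk⇔ (const (¬Hom-C⇒nonzeroCycle ¬c)) (const accepted-YES)
      where
      ¬c : ¬ Hom A (C n)
      ¬c c = contradiction (Equivalence.from (reaches-∷ʳ⁻ r (node-stage n (false ∷ []))) c) λ ()
      accepted-YES : node 0 (stage n ∷ʳ false ∷ʳ false) ≡ YES
      accepted-YES = trans (cong (node 0) (List.∷ʳ-++ (stage n) false (false ∷ [])))
                           (node-stage n (false ∷ false ∷ []))

  search-stops : Σ ℕ (DecidedFrom A) → Σ (List Bool) (Path search A)
  search-stops (n₀ , decided) = run n₀ 0 (ℕ.≤-reflexive (sym (ℕ.+-identityʳ n₀))) start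
    where
    run : ∀ fuel n → n₀ ≤ fuel ℕ.+ n → Reaches search A (stage n) →
          Σ (List Bool) (Path search A)
    run fuel n n₀≤ r with Hom? A (P n)
    ... | yes p = -, reject r p
    ... | no ¬p with Hom? A (C n)
    ...   | no ¬c = -, accept r ¬p ¬c
    ...   | yes c with fuel
    ...     | zero  = contradiction c (Sum.[ flip contradiction ¬p , id ]′ (decided n n₀≤))
    ...     | suc f = run f (suc n) (subst (n₀ ≤_) (sym (ℕ.+-suc f n)) n₀≤) (continue r ¬p c)

search-decides : Decides search HasNonzeroCycle
search-decides = (λ A → search-stops (eventually-decided A)) , λ A → search-sound {A}

-- No k-query algorithm decides 𝒞

querySize : Node → ℕ
querySize (query F) = size F
querySize YES       = 0
querySize NO        = 0

maxQuerySize : ℕ → (List Bool → Node) → ℕ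
maxQuerySize zero    g = 0
maxQuerySize (suc k) g =
  querySize (g []) ⊔ (maxQuerySize k (g ∘ (true ∷_)) ⊔ maxQuerySize k (g ∘ (false ∷_)))

querySize≤max : ∀ k g σ → List.length σ < k → querySize (g σ) ≤ maxQuerySize k g
querySize≤max (suc k) g []          _         = ℕ.m≤m⊔n _ _
querySize≤max (suc k) g (true ∷ σ)  (s≤s σ<k) =
  ℕ.≤-trans (querySize≤max k (g ∘ (true ∷_)) σ σ<k)
            (ℕ.≤-trans (ℕ.m≤m⊔n _ _) (ℕ.m≤n⊔m (querySize (g [])) _))
querySize≤max (suc k) g (false ∷ σ) (s≤s σ<k) =
  ℕ.≤-trans (querySize≤max k (g ∘ (false ∷_)) σ σ<k)
            (ℕ.≤-trans (ℕ.m≤n⊔m _ _) (ℕ.m≤n⊔m (querySize (g [])) _))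

reaches-transfer : ∀ (G : Algorithm) k {A B} →
                   (∀ σ F → List.length σ < k → G .Algorithm.G σ ≡ query F → Hom A F ⇔ Hom B F) →
                   ∀ {σ} → Reaches G A σ → List.length σ ≤ k → Reaches G B σ
reaches-transfer G k agree start _ = start
reaches-transfer G k agree (step {σ} {F} r t asked answered) σb≤k =
  step (reaches-transfer G k agree r (ℕ.<⇒≤ σ<k)) t asked (⇔.trans answered (agree σ F σ<k asked))
  where
  σ<k : List.length σ < k
  σ<k = subst (_≤ k) (trans (List.length-++ σ) (ℕ.+-comm (List.length σ) 1)) σb≤k

suc∣! : ∀ {ℓ n} → ℓ < n → suc ℓ ∣ n !
suc∣! {ℓ} ℓ<n = ∣-trans (m∣m*n (ℓ !)) (m≤n⇒m!∣n! ℓ<n)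

foolingSize : ℕ → ℕ
foolingSize M = pred (suc (suc M) !)

P⇔C-small : ∀ {M F} → size F ≤ M → Hom (P (foolingSize M)) F ⇔ Hom (C (foolingSize M)) F
P⇔C-small {M} {F} F≤M = P⇔C {K} {F} F<K λ ℓ ℓ≤F →
  subst (suc ℓ ∣_) (sym K+1≡) (suc∣! (s≤s (ℕ.≤-trans ℓ≤F (ℕ.m≤n⇒m≤1+n F≤M))))
  where
  K : ℕ
  K = foolingSize M
  K+1≡ : suc K ≡ suc (suc M) !
  K+1≡ = ℕ.suc-pred (suc (suc M) !) {{suc (suc M) ℕ.!≢0}}
  F<K : size F < K
  F<K = ℕ.s≤s⁻¹ $ subst (suc (suc (size F)) ≤_) (sym K+1≡) $
    ℕ.≤-trans (s≤s (s≤s F≤M)) (∣⇒≤ {{suc (suc M) ℕ.!≢0}} (suc∣! (ℕ.n<1+n (suc M))))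

no-bounded-search : ∀ k G → ¬ (Decides G HasNonzeroCycle × IsKQuery k G)
no-bounded-search k G ((total , correct) , bounded) =
  Hom-P⇒¬nonzeroCycle {P K} {K} (id , λ _ _ → id) (Equivalence.to (correct (P K) σ path-P) C-YES)
  where
  M K : ℕ
  M = maxQuerySize k (G .Algorithm.G)
  K = foolingSize M

  agree : ∀ σ F → List.length σ < k → G .Algorithm.G σ ≡ query F → Hom (P K) F ⇔ Hom (C K) F
  agree σ F σ<k asked =
    P⇔C-small {M} {F} $ subst (_≤ M) (cong querySize asked) $
      querySize≤max k (G .Algorithm.G) σ σ<k

  σ : List Bool
  σ = proj₁ (total (P K))
  path-P : Path G (P K) σ
  path-P = proj₂ (total (P K))
  path-C : Path G (C K) σ
  path-C = reaches-transfer G k agree (proj₁ path-P) (bounded (P K) σ path-P) , proj₂ path-P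
  C-YES : G .Algorithm.G σ ≡ YES
  C-YES = Equivalence.from (correct (C K) σ path-C) (C-nonzeroCycle K)

theorem29 : Σ Algorithm (λ G → Decides G HasNonzeroCycle)
            × (∀ (k : ℕ) (G : Algorithm) → ¬ (Decides G HasNonzeroCycle × IsKQuery k G))
theorem29 = (search , search-decides) , no-bounded-search
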